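{- For every small bipointed type $A=(A,a_0,a_1)$, the type $\mathsf{isind}(A)$ is a mere proposition.
   Context: Work in the intensional Martin-Löf type theory $\mathcal{H}$ with $\Sigma$-types, $\Pi$-types (with judgemental $\eta$), identity types, a universe $\mathsf{U}$, and function extensionality; no UIP. A type $X$ is a mere proposition if for all $x,y:X$ the type $\mathsf{Id}_X(x,y)$ is contractible (contractible: $(\Sigma z:Z)(\Pi w:Z)\mathsf{Id}(z,w)$ inhabited). A small bipointed type is $(A,a_0,a_1)$ with $A:\mathsf{U}$, $a_0,a_1:A$. A small fibered bipointed type over it is $(E,e_0,e_1)$ with $E:A\to\mathsf{U}$, $e_k:E(a_k)$; $\mathsf{FibBip}(A)$ is the type of these. A bipointed section is $(f,\bar f_0,\bar f_1)$ with $f:(\Pi x:A)E(x)$, $\bar f_k:\mathsf{Id}_{E(a_k)}(fa_k,e_k)$; $\mathsf{BipSec}(A,E)$ is the type of these. $\mathsf{isind}(A):=(\Pi E:\mathsf{FibBip}(A))\mathsf{BipSec}(A,E)$. -}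

{-# OPTIONS --without-K #-}
module Defs where

open import Level using (Level; _⊔_; Setω)
open import Data.Product using (Σ; _×_; _,_)
open import Relation.Binary.PropositionalEquality using (_≡_)

isContr : ∀ {ℓ} → Set ℓ → Set ℓ
isContr Z = Σ Z (λ z → (w : Z) → z ≡ w)

isProp : ∀ {ℓ} → Set ℓ → Set ℓ
isProp X = (x y : X) → isContr (x ≡ y)

record Bip : Set₁ where
  constructor bip
  field
    A  : Set
    a₀ : A
    a₁ : A

FibBip : Bip → Set₁
FibBip (bip A a₀ a₁) = Σ (A → Set) (λ E → E a₀ × E a₁)

BipSec : (A : Bip) → FibBip A → Set
BipSec (bip A a₀ a₁) (E , e₀ , e₁) =
  Σ ((x : A) → E x) (λ f → (f a₀ ≡ e₀) × (f a₁ ≡ e₁))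

isind : Bip → Set₁
isind A = (E : FibBip A) → BipSec A E

-- function extensionality (for dependent functions), an axiom of the theory H
FunExt : Setω
FunExt = ∀ {a b : Level} {X : Set a} {Y : X → Set b} {f g : (x : X) → Y x}
  → ((x : X) → f x ≡ g x) → f ≡ g

{-# OPTIONS --without-K #-}
-- If A is bipointed-inductive, any two bipointed sections f, g of a fibered
-- bipointed type E are homotopic as bipointed sections: induction into the
-- fibered bipointed type x ↦ f x ≡ g x, pointed by f₀ · g₀⁻¹ and f₁ · g₁⁻¹,
-- yields the homotopy.  With function extensionality, bipointed homotopies
-- give equalities, so each BipSec A E is contractible, hence so is the
-- product isind A, and a type that is contractible as soon as it is
-- inhabited is a mere proposition.
module Submission where

open import Defs
open import Data.Product using (Σ; _×_; _,_; proj₁; proj₂)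
open import Relation.Binary.PropositionalEquality
  using (_≡_; refl; sym; trans; cong; subst; module ≡-Reasoning)
open import Relation.Binary.PropositionalEquality.Properties
  using (trans-assoc; trans-symˡ; trans-reflʳ)

isContr→isProp : ∀ {ℓ} {X : Set ℓ} → isContr X → isProp X
isContr→isProp (_ , contr) x y = trans (sym (contr x)) (contr y) , canonical
  where
  canonical : (p : x ≡ y) → trans (sym (contr x)) (contr y) ≡ p
  canonical refl = trans-symˡ (contr x)

isProp-if-isContr-when-inhabited : ∀ {ℓ} {X : Set ℓ} → (X → isContr X) → isProp X
isProp-if-isContr-when-inhabited contr x = isContr→isProp (contr x) x

trans-sym-cancelʳ : ∀ {ℓ} {X : Set ℓ} {u v w : X} (p : u ≡ w) (q : v ≡ w) →
                    trans (trans p (sym q)) q ≡ p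
trans-sym-cancelʳ p q = begin
  trans (trans p (sym q)) q  ≡⟨ trans-assoc p ⟩
  trans p (trans (sym q) q)  ≡⟨ cong (trans p) (trans-symˡ q) ⟩
  trans p refl               ≡⟨ trans-reflʳ p ⟩
  p                          ∎
  where open ≡-Reasoning

_∼_ : ∀ {a b} {X : Set a} {Y : X → Set b} (f g : (x : X) → Y x) → Set _
f ∼ g = ∀ x → f x ≡ g x

module _ (fe : FunExt) where

  Π-isContr : ∀ {a b} {X : Set a} {Y : X → Set b} →
              ((x : X) → isContr (Y x)) → isContr ((x : X) → Y x)
  Π-isContr contr = (λ x → proj₁ (contr x)) , λ g → fe (λ x → proj₂ (contr x) (g x))

  ∼-singleton-isContr : ∀ {a b} {X : Set a} {Y : X → Set b} (f : (x : X) → Y x) →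
                        isContr (Σ ((x : X) → Y x) (f ∼_))
  ∼-singleton-isContr {X = X} {Y} f =
    (f , λ _ → refl) , λ { (g , h) → cong unzip (proj₂ pointwise (λ x → g x , h x)) }
    where
    pointwise : isContr ((x : X) → Σ (Y x) (f x ≡_))
    pointwise = Π-isContr λ x → (f x , refl) , λ { (_ , refl) → refl }
    unzip : ((x : X) → Σ (Y x) (f x ≡_)) → Σ ((x : X) → Y x) (f ∼_)
    unzip u = (λ x → proj₁ (u x)) , (λ x → proj₂ (u x))

  ∼-ind : ∀ {a b p} {X : Set a} {Y : X → Set b} {f : (x : X) → Y x}
          (P : (g : (x : X) → Y x) → f ∼ g → Set p) →
          P f (λ _ → refl) → ∀ g (h : f ∼ g) → P g h
  ∼-ind {f = f} P base g h =
    subst (λ (gh : Σ _ (f ∼_)) → P (proj₁ gh) (proj₂ gh))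
          (proj₂ (∼-singleton-isContr f) (g , h)) base

module _ {A : Bip} {E : FibBip A} where
  open Bip A using (a₀; a₁)

  BipHtpy : BipSec A E → BipSec A E → Set
  BipHtpy (f , f₀ , f₁) (g , g₀ , g₁) =
    Σ (f ∼ g) λ h → (trans (h a₀) g₀ ≡ f₀) × (trans (h a₁) g₁ ≡ f₁)

  BipHtpy→≡ : FunExt → (s t : BipSec A E) → BipHtpy s t → s ≡ t
  -- The endpoint paths g₀, g₁ are generalised so that, once h is refl,
  -- they can be matched against f₀, f₁.
  BipHtpy→≡ fe (f , f₀ , f₁) (g , g₀ , g₁) (h , h₀ , h₁) =
    ∼-ind fe (λ g h → ∀ g₀ g₁ → trans (h a₀) g₀ ≡ f₀ → trans (h a₁) g₁ ≡ f₁ →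
                      (f , f₀ , f₁) ≡ (g , g₀ , g₁))
          (λ { _ _ refl refl → refl }) g h g₀ g₁ h₀ h₁

  isind→BipHtpy : isind A → (s t : BipSec A E) → BipHtpy s t
  isind→BipHtpy ind (f , f₀ , f₁) (g , g₀ , g₁)
    with ind ((λ x → f x ≡ g x) , trans f₀ (sym g₀) , trans f₁ (sym g₁))
  ... | h , h₀ , h₁ =
    h , endpoint f₀ g₀ h₀ , endpoint f₁ g₁ h₁
    where
    endpoint : ∀ {x e} {hx : f x ≡ g x} (p : f x ≡ e) (q : g x ≡ e) →
               hx ≡ trans p (sym q) → trans hx q ≡ p
    endpoint p q refl = trans-sym-cancelʳ p q

isind→BipSec-isContr : FunExt → (A : Bip) → isind A → (E : FibBip A) → isContr (BipSec A E)
isind→BipSec-isContr fe A ind E =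
  ind E , λ t → BipHtpy→≡ fe (ind E) t (isind→BipHtpy ind (ind E) t)

proposition3p4 : FunExt → (A : Bip) → isProp (isind A)
proposition3p4 fe A =
  isProp-if-isContr-when-inhabited λ ind → Π-isContr fe (isind→BipSec-isContr fe A ind)
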